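{- Let $\mathcal{S}=\langle S,s_0,\tau,l\rangle$ be a $\Gamma$-labeled $\Upsilon$-transition system, let $\forall\pi_1\ldots\forall\pi_n.\ \exists\pi'_1\ldots\exists\pi'_m.\ \varphi$ be a HyperLTL formula with $\varphi$ quantifier-free, and let $\mathcal{S}_\exists=\langle X,x_0,\mu,l_\exists\rangle$ with $X$ finite, $x_0\in X$, $\mu\colon X\times\Upsilon^n\to X$, $l_\exists\colon X\to\Upsilon^m$. Let $\mathcal{A}_\varphi=\langle Q,q_0,\delta,F\rangle$ be a universal co-Büchi automaton for $\varphi$. If the run graph $\mathcal{S}^n\times(\mathcal{S}^m\,\|\,\mathcal{S}_\exists)\times\mathcal{A}_\varphi$ is accepting, then $\mathcal{S}\models\forall\pi_1\ldots\forall\pi_n.\ \exists\pi'_1\ldots\exists\pi'_m.\ \varphi$.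
   Context: $I,O$ disjoint finite proposition sets, $\Upsilon=2^I$, $\Gamma=2^O$, $\mathrm{AP}=I\cup O$, $\Sigma=2^{\mathrm{AP}}$. A $\Gamma$-labeled $\Upsilon$-transition system $\langle S,s_0,\tau,l\rangle$: finite $S$, $s_0\in S$, $\tau\colon S\times\Upsilon\to S$, $l\colon S\to\Gamma$; $\tau^*(\epsilon)=s_0$, $\tau^*(x\upsilon)=\tau(\tau^*(x),\upsilon)$; the trace on $\upsilon_0\upsilon_1\ldots\in\Upsilon^\omega$ is $(\upsilon_0\cup\gamma_0)(\upsilon_1\cup\gamma_1)\ldots$ with $\gamma_i=l(\tau^*(\upsilon_0\cdots\upsilon_{i-1}))$, and $\mathit{traces}(\mathcal{S})$ is the set of all traces. For $k\ge0$, $\tau_k\colon S^k\times\Upsilon^k\to S^k$ and $l_k\colon S^k\to\Gamma^k$ apply $\tau$ and $l$ componentwise. A universal co-Büchi automaton for $\varphi$ is $\mathcal{A}_\varphi=\langle Q,q_0,\delta,F\rangle$ with finite $Q$, $q_0\in Q$, rejecting set $F\subseteq Q$ and $\delta\colon Q\times\Upsilon^{n+m}\times\Gamma^{n+m}\to 2^Q$; it accepts a word $(\vec\upsilon_0,\vec\gamma_0)(\vec\upsilon_1,\vec\gamma_1)\ldots$ iff every infinite sequence $q_0q_1\ldots$ with $q_{i+1}\in\delta(q_i,\vec\upsilon_i,\vec\gamma_i)$ visits $F$ only finitely often. "For $\varphi$" means: it accepts exactly those words for which the assignment mapping $\pi_j$ ($1\le j\le n$) to the trace $(\upsilon_0^j\cup\gamma_0^j)(\upsilon_1^j\cup\gamma_1^j)\ldots$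 and $\pi'_k$ to $(\upsilon_0^{n+k}\cup\gamma_0^{n+k})\ldots$ satisfies $\varphi$ at position $0$ (standard LTL semantics with $a_\pi$ true at $i$ iff $a\in\Pi(\pi)[i]$). The run graph $\mathcal{S}^n\times(\mathcal{S}^m\,\|\,\mathcal{S}_\exists)\times\mathcal{A}_\varphi$ is the directed graph with vertices $S^n\times S^m\times X\times Q$, initial vertex $v_{init}=((s_0,\dots,s_0),(s_0,\dots,s_0),x_0,q_0)$, and an edge from $(\vec s_n,\vec s_m,x,q)$ to $(\vec s_n',\vec s_m',x',q')$ iff there is $\vec\upsilon\in\Upsilon^n$ with $\vec s_n'=\tau_n(\vec s_n,\vec\upsilon)$, $\vec s_m'=\tau_m(\vec s_m,l_\exists(x))$, $x'=\mu(x,\vec\upsilon)$, and $q'\in\delta(q,\vec\upsilon\cdot l_\exists(x),l_n(\vec s_n)\cdot l_m(\vec s_m))$ ($\cdot$ is tuple concatenation). It is accepting iff every infinite path starting in $v_{init}$ visits only finitely often vertices whose $Q$-component lies in $F$. $\mathcal{S}\models\forall\pi_1\ldots\exists\pi'_m.\varphi$ is HyperLTL satisfaction with trace quantifiers ranging over $\mathit{traces}(\mathcal{S})$. -}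

module Defs where

open import Data.Nat using (ℕ; zero; suc; _+_; _≤_)
open import Data.Fin using (Fin)
open import Data.Fin.Subset using (Subset; _∈_; _∉_)
open import Data.Bool using (Bool; true)
open import Data.Sum using (_⊎_; [_,_])
open import Data.Product using (_×_; _,_; proj₁; proj₂; ∃-syntax)
open import Data.Empty using (⊥)
open import Data.Unit using (⊤)
open import Data.Vec.Functional using (Vector; _++_)
open import Relation.Binary.PropositionalEquality using (_≡_)
open import Function.Bundles using (_⇔_)

-- Propositions: I = Fin nI, O = Fin nO (disjoint via the sum), AP = I ∪ O

AP : ℕ → ℕ → Set
AP nI nO = Fin nI ⊎ Fin nO

-- Υ = 2^I, Γ = 2^O, Σ = 2^AP (subsets as characteristic functions)
Υ : ℕ → Set
Υ nI = Fin nI → Bool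

Γ : ℕ → Set
Γ nO = Fin nO → Bool

Letter : ℕ → ℕ → Set
Letter nI nO = AP nI nO → Bool

_∪ₗ_ : ∀ {nI nO} → Υ nI → Γ nO → Letter nI nO
υ ∪ₗ γ = [ υ , γ ]

Trace : ℕ → ℕ → Set
Trace nI nO = ℕ → Letter nI nO

record TS (In Lab : Set) : Set where
  field
    nS : ℕ
    s₀ : Fin nS
    τ  : Fin nS → In → Fin nS
    l  : Fin nS → Lab
open TS public

-- τ*(υ₀ ⋯ υ_{i-1}) for an infinite input sequence
τ* : ∀ {In Lab} (𝒮 : TS In Lab) → (ℕ → In) → ℕ → Fin (nS 𝒮)
τ* 𝒮 υs zero    = s₀ 𝒮
τ* 𝒮 υs (suc i) = τ 𝒮 (τ* 𝒮 υs i) (υs i)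

traceOn : ∀ {nI nO} (𝒮 : TS (Υ nI) (Γ nO)) → (ℕ → Υ nI) → Trace nI nO
traceOn 𝒮 υs i = υs i ∪ₗ l 𝒮 (τ* 𝒮 υs i)

InTraces : ∀ {nI nO} (𝒮 : TS (Υ nI) (Γ nO)) → Trace nI nO → Set
InTraces 𝒮 t = ∃[ υs ] (∀ i a → t i a ≡ traceOn 𝒮 υs i a)

τₖ : ∀ {In Lab k} (𝒮 : TS In Lab) → Vector (Fin (nS 𝒮)) k → Vector In k → Vector (Fin (nS 𝒮)) k
τₖ 𝒮 ss υs j = τ 𝒮 (ss j) (υs j)

lₖ : ∀ {In Lab k} (𝒮 : TS In Lab) → Vector (Fin (nS 𝒮)) k → Vector Lab k
lₖ 𝒮 ss j = l 𝒮 (ss j)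

data QF (nI nO k : ℕ) : Set where
  tt   : QF nI nO k
  atom : AP nI nO → Fin k → QF nI nO k
  ¬'_  : QF nI nO k → QF nI nO k
  _∧'_ : QF nI nO k → QF nI nO k → QF nI nO k
  X'_  : QF nI nO k → QF nI nO k
  _U'_ : QF nI nO k → QF nI nO k → QF nI nO k

_,_⊨_ : ∀ {nI nO k} → Vector (Trace nI nO) k → ℕ → QF nI nO k → Set
Π , i ⊨ tt         = ⊤
Π , i ⊨ atom a π   = Π π i a ≡ true
Π , i ⊨ (¬' φ)     = Π , i ⊨ φ → ⊥
Π , i ⊨ (φ ∧' ψ)   = (Π , i ⊨ φ) × (Π , i ⊨ ψ)
Π , i ⊨ (X' φ)     = Π , suc i ⊨ φ
Π , i ⊨ (φ U' ψ)   = ∃[ k ] (i ≤ k × (Π , k ⊨ ψ) × (∀ j → i ≤ j → suc j ≤ k → Π , j ⊨ φ))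

-- 𝒮 ⊨ ∀π₁…∀πₙ. ∃π'₁…∃π'ₘ. φ   (π_j ↦ index j, π'_k ↦ index n+k)
ModelsAE : ∀ {nI nO} (𝒮 : TS (Υ nI) (Γ nO)) (n m : ℕ) → QF nI nO (n + m) → Set
ModelsAE {nI} {nO} 𝒮 n m φ =
  (ts : Vector (Trace nI nO) n) → (∀ j → InTraces 𝒮 (ts j)) →
  ∃[ ts' ] ((∀ k → InTraces 𝒮 (ts' k)) × ((ts ++ ts') , 0 ⊨ φ))

record UCA (nI nO k : ℕ) : Set where
  field
    nQ : ℕ
    q₀ : Fin nQ
    δ  : Fin nQ → Vector (Υ nI) k → Vector (Γ nO) k → Subset nQ
    F  : Subset nQ
open UCA public

Word : ℕ → ℕ → ℕ → Set
Word nI nO k = ℕ → Vector (Υ nI) k × Vector (Γ nO) k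

FinitelyOftenIn : ∀ {nQ} → Subset nQ → (ℕ → Fin nQ) → Set
FinitelyOftenIn F qs = ∃[ N ] (∀ i → N ≤ i → qs i ∉ F)

IsRun : ∀ {nI nO k} (𝒜 : UCA nI nO k) → Word nI nO k → (ℕ → Fin (nQ 𝒜)) → Set
IsRun 𝒜 w qs = (qs 0 ≡ q₀ 𝒜) × (∀ i → qs (suc i) ∈ δ 𝒜 (qs i) (proj₁ (w i)) (proj₂ (w i)))

Accepts : ∀ {nI nO k} (𝒜 : UCA nI nO k) → Word nI nO k → Set
Accepts 𝒜 w = ∀ qs → IsRun 𝒜 w qs → FinitelyOftenIn (F 𝒜) qs

assignOf : ∀ {nI nO k} → Word nI nO k → Vector (Trace nI nO) k
assignOf w j i = proj₁ (w i) j ∪ₗ proj₂ (w i) j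

IsUCAFor : ∀ {nI nO k} → UCA nI nO k → QF nI nO k → Set
IsUCAFor 𝒜 φ = ∀ w → Accepts 𝒜 w ⇔ (assignOf w , 0 ⊨ φ)

module RunGraph {nI nO n m : ℕ}
  (𝒮 : TS (Υ nI) (Γ nO))
  (𝒮∃ : TS (Vector (Υ nI) n) (Vector (Υ nI) m))
  (𝒜 : UCA nI nO (n + m)) where

  Vertex : Set
  Vertex = Vector (Fin (nS 𝒮)) n × Vector (Fin (nS 𝒮)) m × Fin (nS 𝒮∃) × Fin (nQ 𝒜)

  vinit : Vertex
  vinit = (λ _ → s₀ 𝒮) , (λ _ → s₀ 𝒮) , s₀ 𝒮∃ , q₀ 𝒜

  qOf : Vertex → Fin (nQ 𝒜)
  qOf (_ , _ , _ , q) = q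

  Edge : Vertex → Vertex → Set
  Edge (sn , sm , x , q) (sn' , sm' , x' , q') =
    ∃[ υ ] ( (∀ j → sn' j ≡ τₖ 𝒮 sn υ j)
           × (∀ j → sm' j ≡ τₖ 𝒮 sm (l 𝒮∃ x) j)
           × (x' ≡ τ 𝒮∃ x υ)
           × (q' ∈ δ 𝒜 q (υ ++ l 𝒮∃ x) (lₖ 𝒮 sn ++ lₖ 𝒮 sm)))

  IsPath : (ℕ → Vertex) → Set
  IsPath p = (p 0 ≡ vinit) × (∀ i → Edge (p i) (p (suc i)))

  Accepting : Set
  Accepting = ∀ p → IsPath p → FinitelyOftenIn (F 𝒜) (λ i → qOf (p i))

RunGraphAccepting : ∀ {nI nO n m}
  (𝒮 : TS (Υ nI) (Γ nO)) (𝒮∃ : TS (Vector (Υ nI) n) (Vector (Υ nI) m))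
  (𝒜 : UCA nI nO (n + m)) → Set
RunGraphAccepting 𝒮 𝒮∃ 𝒜 = RunGraph.Accepting 𝒮 𝒮∃ 𝒜

module Submission where

-- Fix universally quantified traces t₁ … tₙ of 𝒮, generated by
-- input sequences υ¹ … υⁿ.  Running the strategy 𝒮∃ on the joint input
-- sequence yields, at every step, m further inputs; feeding these to 𝒮
-- produces the existential witness traces t'₁ … t'ₘ.  Joining the inputs and
-- the outputs of all n + m copies of 𝒮 gives one word w for 𝒜.  The states
-- visited along this construction, paired with any run of 𝒜 on w, form a path
-- of the run graph; so acceptance of the run graph makes 𝒜 accept w, and since
-- 𝒜 recognises φ, the assignment of w satisfies φ.  That assignment agrees
-- pointwise with t ++ t', and satisfaction of quantifier-free formulas only
-- depends on the traces pointwise, which finishes the proof.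

open import Defs
open import Data.Nat using (ℕ; _+_; suc)
open import Data.Vec.Functional using (Vector; _++_)
open import Data.Fin using (Fin; splitAt)
open import Data.Sum using (inj₁; inj₂)
open import Data.Product using (_,_; proj₁; proj₂)
open import Relation.Binary.PropositionalEquality using (_≡_; refl; sym; trans; cong)
open import Function.Bundles using (Equivalence)

_≋_ : ∀ {nI nO k} → Vector (Trace nI nO) k → Vector (Trace nI nO) k → Set
Π ≋ Π' = ∀ j i a → Π j i a ≡ Π' j i a

≋-sym : ∀ {nI nO k} {Π Π' : Vector (Trace nI nO) k} → Π ≋ Π' → Π' ≋ Π
≋-sym eq j i a = sym (eq j i a)

≋-trans : ∀ {nI nO k} {Π Π' Π'' : Vector (Trace nI nO) k} → Π ≋ Π' → Π' ≋ Π'' → Π ≋ Π''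
≋-trans eq eq' j i a = trans (eq j i a) (eq' j i a)

++-≋ : ∀ {nI nO k l} {Π₁ Π₁' : Vector (Trace nI nO) k} {Π₂ Π₂' : Vector (Trace nI nO) l} →
  Π₁ ≋ Π₁' → Π₂ ≋ Π₂' → (Π₁ ++ Π₂) ≋ (Π₁' ++ Π₂')
++-≋ {k = k} eq₁ eq₂ j i a with splitAt k j
... | inj₁ j₁ = eq₁ j₁ i a
... | inj₂ j₂ = eq₂ j₂ i a

-- Satisfaction of a quantifier-free formula is invariant under pointwise
-- equality of assignments (negation needs the converse, hence ≋-sym).
⊨-resp-≋ : ∀ {nI nO k} {Π Π' : Vector (Trace nI nO) k} →
  Π ≋ Π' → ∀ φ i → Π , i ⊨ φ → Π' , i ⊨ φ
⊨-resp-≋ eq tt         i _ = _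
⊨-resp-≋ eq (atom a π) i h = trans (sym (eq π i a)) h
⊨-resp-≋ eq (¬' φ)     i h = λ h' → h (⊨-resp-≋ (≋-sym eq) φ i h')
⊨-resp-≋ eq (φ ∧' ψ)   i (hφ , hψ) = ⊨-resp-≋ eq φ i hφ , ⊨-resp-≋ eq ψ i hψ
⊨-resp-≋ eq (X' φ)     i h = ⊨-resp-≋ eq φ (suc i) h
⊨-resp-≋ eq (φ U' ψ)   i (k , i≤k , hψ , hφ) =
  k , i≤k , ⊨-resp-≋ eq ψ k hψ , λ j i≤j j<k → ⊨-resp-≋ eq φ j (hφ j i≤j j<k)

module StrategyWord {nI nO n m : ℕ}
  (𝒮 : TS (Υ nI) (Γ nO))
  (𝒮∃ : TS (Vector (Υ nI) n) (Vector (Υ nI) m))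
  (υs : Vector (ℕ → Υ nI) n) where

  jointInput : ℕ → Vector (Υ nI) n
  jointInput i j = υs j i

  strategyState : ℕ → Fin (nS 𝒮∃)
  strategyState = τ* 𝒮∃ jointInput

  witnessInputs : Vector (ℕ → Υ nI) m
  witnessInputs k i = l 𝒮∃ (strategyState i) k

  witnessTraces : Vector (Trace nI nO) m
  witnessTraces k = traceOn 𝒮 (witnessInputs k)

  universalStates : ℕ → Vector (Fin (nS 𝒮)) n
  universalStates i j = τ* 𝒮 (υs j) i

  existentialStates : ℕ → Vector (Fin (nS 𝒮)) m
  existentialStates i k = τ* 𝒮 (witnessInputs k) i

  word : Word nI nO (n + m)
  word i = (jointInput i ++ l 𝒮∃ (strategyState i))
         , (lₖ 𝒮 (universalStates i) ++ lₖ 𝒮 (existentialStates i))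

  assignOf-word : assignOf word ≋ ((λ j → traceOn 𝒮 (υs j)) ++ witnessTraces)
  assignOf-word j i a with splitAt n j
  ... | inj₁ _ = refl
  ... | inj₂ _ = refl

  runIsPath : (𝒜 : UCA nI nO (n + m)) (qs : ℕ → Fin (nQ 𝒜)) → IsRun 𝒜 word qs →
    RunGraph.IsPath 𝒮 𝒮∃ 𝒜
      (λ i → universalStates i , existentialStates i , strategyState i , qs i)
  runIsPath 𝒜 qs (q0 , step) =
    cong (λ q → (λ _ → s₀ 𝒮) , (λ _ → s₀ 𝒮) , s₀ 𝒮∃ , q) q0 ,
    λ i → jointInput i , (λ _ → refl) , (λ _ → refl) , refl , step i

  acceptsWord : (𝒜 : UCA nI nO (n + m)) → RunGraphAccepting 𝒮 𝒮∃ 𝒜 → Accepts 𝒜 word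
  acceptsWord 𝒜 acc qs run = acc _ (runIsPath 𝒜 qs run)

theorem7 : ∀ {nI nO : ℕ} (𝒮 : TS (Υ nI) (Γ nO)) (n m : ℕ)
    (φ : QF nI nO (n + m))
    (𝒮∃ : TS (Vector (Υ nI) n) (Vector (Υ nI) m))
    (𝒜 : UCA nI nO (n + m)) →
    IsUCAFor 𝒜 φ →
    RunGraphAccepting 𝒮 𝒮∃ 𝒜 →
    ModelsAE 𝒮 n m φ
theorem7 𝒮 n m φ 𝒮∃ 𝒜 isUCA acc ts ts∈𝒮 =
  witnessTraces , (λ k → witnessInputs k , λ _ _ → refl) , ts++ts'⊨φ
  where
  open StrategyWord 𝒮 𝒮∃ (λ j → proj₁ (ts∈𝒮 j))

  word⊨φ : assignOf word , 0 ⊨ φ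
  word⊨φ = Equivalence.to (isUCA word) (acceptsWord 𝒜 acc)

  -- each given trace is the trace of its chosen input sequence
  assignOf≋ts++ts' : assignOf word ≋ (ts ++ witnessTraces)
  assignOf≋ts++ts' = ≋-trans assignOf-word
    (++-≋ (λ j i a → sym (proj₂ (ts∈𝒮 j) i a)) (λ _ _ _ → refl))

  ts++ts'⊨φ : (ts ++ witnessTraces) , 0 ⊨ φ
  ts++ts'⊨φ = ⊨-resp-≋ assignOf≋ts++ts' φ 0 word⊨φ
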